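{- For every $\text{rPrompt-LTL}$ formula $\varphi$ and every $\beta \in \mathbb{B}_4$ there is a $\text{Prompt-LTL}$ formula $\varphi_\beta$ of size $O(|\varphi|)$ such that for every trace $w \in (2^P)^\omega$ and every $k \in \mathbb{N}$: $V^{\mathrm{rP}}(w,k,\varphi) \succeq \beta$ if and only if $V^{\mathrm{P}}(w,k,\varphi_\beta) = 1$.
   Context: Fix a finite non-empty set $P$ of atomic propositions. A trace is $w = w(0)w(1)w(2)\cdots \in (2^P)^\omega$; for $j \in \mathbb{N}$, $w[j,\infty) = w(j)w(j+1)\cdots$ is its suffix from position $j$. The truth values of robust semantics are $\mathbb{B}_4 = \{0000,0001,0011,0111,1111\}$, totally ordered by $0000 \prec 0001 \prec 0011 \prec 0111 \prec 1111$ ($\preceq$, $\succeq$ the non-strict versions). When $\min,\max$ range over subsets of $\{0,1\}$, $\min\emptyset = 1$ and $\max \emptyset = 0$. $\text{rPrompt-LTL}$ formulas: $\varphi ::= p \mid \neg p \mid \varphi\wedge\varphi \mid \varphi\vee\varphi \mid \dot\Diamond\varphi \mid \dot\Box\varphi \mid \dot\Diamond_{\mathrm P}\varphi$ with $p \in P$. Semantics: a function $V^{\mathrm{rP}}(w,k,\varphi)$ (trace $w$, bound $k\in\mathbb{N}$) with value a four-bit string $b_1b_2b_3b_4$; write $V^{\mathrm{rP}}_i$ for the $i$-th bit. $V^{\mathrm{rP}}(w,k,p)=1111$ if $p\in w(0)$ and $0000$ otherwise; $V^{\mathrm{rP}}(w,k,\neg p) = 1111$ if $p\notin w(0)$ and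 $0000$ otherwise; conjunction is $\min$ and disjunction is $\max$ w.r.t. $\preceq$; $V^{\mathrm{rP}}(w,k,\dot\Diamond\varphi)$ has bits $b_i = \max_{j\in\mathbb{N}} V^{\mathrm{rP}}_i(w[j,\infty),k,\varphi)$; $V^{\mathrm{rP}}(w,k,\dot\Box\varphi)$ has bits $b_1 = \min_{j} V^{\mathrm{rP}}_1(w[j,\infty),k,\varphi)$, $b_2 = \max_{j'}\min_{j\ge j'} V^{\mathrm{rP}}_2(w[j,\infty),k,\varphi)$, $b_3 = \min_{j'}\max_{j\ge j'} V^{\mathrm{rP}}_3(w[j,\infty),k,\varphi)$, $b_4 = \max_j V^{\mathrm{rP}}_4(w[j,\infty),k,\varphi)$; $V^{\mathrm{rP}}(w,k,\dot\Diamond_{\mathrm P}\varphi)$ has bits $b_i = \max_{0\le j\le k} V^{\mathrm{rP}}_i(w[j,\infty),k,\varphi)$. $\text{Prompt-LTL}$ formulas: $\psi ::= p \mid \neg p \mid \psi\wedge\psi\mid\psi\vee\psi\mid \mathbf{X}\psi \mid \psi\,\mathbf{U}\,\psi \mid \psi\,\mathbf{R}\,\psi \mid \Diamond_{\mathrm P}\psi$, with Boolean semantics $V^{\mathrm P}(w,k,\psi)\in\{0,1\}$: atoms and negated atoms as usual on $w(0)$, $\wedge$ is $\min$, $\vee$ is $\max$, $V^{\mathrm P}(w,k,\mathbf X\psi) = V^{\mathrm P}(w[1,\infty),k,\psi)$, $V^{\mathrm P}(w,k,\psi_0\mathbf U\psi_1) = \max_{j}\min\{V^{\mathrm P}(w[j,\infty),k,\psi_1),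 \min_{0\le j'<j}V^{\mathrm P}(w[j',\infty),k,\psi_0)\}$, $V^{\mathrm P}(w,k,\psi_0\mathbf R\psi_1) = \min_j\max\{V^{\mathrm P}(w[j,\infty),k,\psi_1),\max_{0\le j'\le j}V^{\mathrm P}(w[j',\infty),k,\psi_0)\}$, $V^{\mathrm P}(w,k,\Diamond_{\mathrm P}\psi) = \max_{0\le j\le k}V^{\mathrm P}(w[j,\infty),k,\psi)$. The size of a formula (of either logic) is its number of distinct subformulas. -}

module Defs where

open import Data.Nat using (ℕ; zero; suc; _+_; _≤_; _<_)
open import Data.Fin using (Fin; zero; suc)
import Data.Fin.Properties as FinP
open import Data.Bool using (Bool; true; false)
open import Data.Product using (Σ; ∃; ∃-syntax; _×_; _,_)
open import Data.Sum using (_⊎_)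
open import Data.List using (List; []; _∷_; _++_; length; deduplicate)
open import Relation.Binary.PropositionalEquality using (_≡_; refl; cong)
open import Relation.Binary.Definitions using (DecidableEquality)
open import Relation.Nullary using (yes; no)

-- Atomic propositions: P = Fin n (P non-empty is imposed in the statement
-- by taking n = suc m).  A trace w ∈ (2^P)^ω is a map ℕ → (P → Bool),
-- where  w j p ≡ true  means  p ∈ w(j).

Trace : ℕ → Set
Trace n = ℕ → Fin n → Bool

suffix : ∀ {n} → Trace n → ℕ → Trace n
suffix w j i = w (j + i)

data rPLTL (n : ℕ) : Set where
  atom  : Fin n → rPLTL n
  natom : Fin n → rPLTL n
  _∧_   : rPLTL n → rPLTL n → rPLTL n
  _∨_   : rPLTL n → rPLTL n → rPLTL n
  ◇     : rPLTL n → rPLTL n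
  □     : rPLTL n → rPLTL n
  ◇P    : rPLTL n → rPLTL n

data PLTL (n : ℕ) : Set where
  atom  : Fin n → PLTL n
  natom : Fin n → PLTL n
  _∧_   : PLTL n → PLTL n → PLTL n
  _∨_   : PLTL n → PLTL n → PLTL n
  X     : PLTL n → PLTL n
  _U_   : PLTL n → PLTL n → PLTL n
  _R_   : PLTL n → PLTL n → PLTL n
  ◇P    : PLTL n → PLTL n

-- The truth values B4 = {0000,0001,0011,0111,1111}; bit β i is the
-- (i+1)-th bit b_{i+1} of β.

data B4 : Set where
  b0000 b0001 b0011 b0111 b1111 : B4

bit : B4 → Fin 4 → Bool
bit b0000 _ = false
bit b0001 (suc (suc (suc zero))) = true
bit b0001 _ = false
bit b0011 zero = false
bit b0011 (suc zero) = false
bit b0011 _ = true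
bit b0111 zero = false
bit b0111 _ = true
bit b1111 _ = true

-- Robust semantics.  Vr w k φ i  is the proposition
-- "V^rP_{i+1}(w,k,φ) = 1" (the bits are {0,1}-valued; max over a set of
-- bits is 1 iff some element is 1, min is 1 iff all are 1).

Vr : ∀ {n} → Trace n → ℕ → rPLTL n → Fin 4 → Set
Vr w k (atom p)  i = w 0 p ≡ true
Vr w k (natom p) i = w 0 p ≡ false
Vr w k (φ ∧ ψ)   i = Vr w k φ i × Vr w k ψ i     -- min on B4 is bitwise
Vr w k (φ ∨ ψ)   i = Vr w k φ i ⊎ Vr w k ψ i     -- max on B4 is bitwise
Vr w k (◇ φ)     i = ∃[ j ] Vr (suffix w j) k φ i
Vr w k (□ φ) zero = ∀ j → Vr (suffix w j) k φ zero
Vr w k (□ φ) (suc zero) =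
  ∃[ j′ ] (∀ j → j′ ≤ j → Vr (suffix w j) k φ (suc zero))
Vr w k (□ φ) (suc (suc zero)) =
  ∀ j′ → ∃[ j ] (j′ ≤ j × Vr (suffix w j) k φ (suc (suc zero)))
Vr w k (□ φ) (suc (suc (suc zero))) =
  ∃[ j ] Vr (suffix w j) k φ (suc (suc (suc zero)))
Vr w k (◇P φ)    i = ∃[ j ] (j ≤ k × Vr (suffix w j) k φ i)

-- V ⪰ β for β ∈ B4: since B4 is a chain that is ordered bitwise,
-- V ⪰ β iff every bit that is 1 in β is 1 in V.
_⪰_ : (Fin 4 → Set) → B4 → Set
V ⪰ β = ∀ i → bit β i ≡ true → V i

Vp : ∀ {n} → Trace n → ℕ → PLTL n → Set
Vp w k (atom p)  = w 0 p ≡ true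
Vp w k (natom p) = w 0 p ≡ false
Vp w k (ψ ∧ χ)   = Vp w k ψ × Vp w k χ
Vp w k (ψ ∨ χ)   = Vp w k ψ ⊎ Vp w k χ
Vp w k (X ψ)     = Vp (suffix w 1) k ψ
Vp w k (ψ U χ)   =
  ∃[ j ] (Vp (suffix w j) k χ × (∀ j′ → j′ < j → Vp (suffix w j′) k ψ))
Vp w k (ψ R χ)   =
  ∀ j → Vp (suffix w j) k χ ⊎ (∃[ j′ ] (j′ ≤ j × Vp (suffix w j′) k ψ))
Vp w k (◇P ψ)    = ∃[ j ] (j ≤ k × Vp (suffix w j) k ψ)

module _ {n : ℕ} where

  _≟r_ : DecidableEquality (rPLTL n)
  atom p ≟r atom q with p FinP.≟ q
  ... | yes refl = yes refl
  ... | no ne = no λ { refl → ne refl }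
  natom p ≟r natom q with p FinP.≟ q
  ... | yes refl = yes refl
  ... | no ne = no λ { refl → ne refl }
  (a ∧ b) ≟r (c ∧ d) with a ≟r c | b ≟r d
  ... | yes refl | yes refl = yes refl
  ... | no ne | _ = no λ { refl → ne refl }
  ... | _ | no ne = no λ { refl → ne refl }
  (a ∨ b) ≟r (c ∨ d) with a ≟r c | b ≟r d
  ... | yes refl | yes refl = yes refl
  ... | no ne | _ = no λ { refl → ne refl }
  ... | _ | no ne = no λ { refl → ne refl }
  ◇ a ≟r ◇ c with a ≟r c
  ... | yes refl = yes refl
  ... | no ne = no λ { refl → ne refl }
  □ a ≟r □ c with a ≟r c
  ... | yes refl = yes refl
  ... | no ne = no λ { refl → ne refl }
  ◇P a ≟r ◇P c with a ≟r c
  ... | yes refl = yes refl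
  ... | no ne = no λ { refl → ne refl }
  atom _ ≟r natom _ = no λ ()
  atom _ ≟r (_ ∧ _) = no λ ()
  atom _ ≟r (_ ∨ _) = no λ ()
  atom _ ≟r ◇ _ = no λ ()
  atom _ ≟r □ _ = no λ ()
  atom _ ≟r ◇P _ = no λ ()
  natom _ ≟r atom _ = no λ ()
  natom _ ≟r (_ ∧ _) = no λ ()
  natom _ ≟r (_ ∨ _) = no λ ()
  natom _ ≟r ◇ _ = no λ ()
  natom _ ≟r □ _ = no λ ()
  natom _ ≟r ◇P _ = no λ ()
  (_ ∧ _) ≟r atom _ = no λ ()
  (_ ∧ _) ≟r natom _ = no λ ()
  (_ ∧ _) ≟r (_ ∨ _) = no λ ()
  (_ ∧ _) ≟r ◇ _ = no λ ()
  (_ ∧ _) ≟r □ _ = no λ ()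
  (_ ∧ _) ≟r ◇P _ = no λ ()
  (_ ∨ _) ≟r atom _ = no λ ()
  (_ ∨ _) ≟r natom _ = no λ ()
  (_ ∨ _) ≟r (_ ∧ _) = no λ ()
  (_ ∨ _) ≟r ◇ _ = no λ ()
  (_ ∨ _) ≟r □ _ = no λ ()
  (_ ∨ _) ≟r ◇P _ = no λ ()
  ◇ _ ≟r atom _ = no λ ()
  ◇ _ ≟r natom _ = no λ ()
  ◇ _ ≟r (_ ∧ _) = no λ ()
  ◇ _ ≟r (_ ∨ _) = no λ ()
  ◇ _ ≟r □ _ = no λ ()
  ◇ _ ≟r ◇P _ = no λ ()
  □ _ ≟r atom _ = no λ ()
  □ _ ≟r natom _ = no λ ()
  □ _ ≟r (_ ∧ _) = no λ ()
  □ _ ≟r (_ ∨ _) = no λ ()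
  □ _ ≟r ◇ _ = no λ ()
  □ _ ≟r ◇P _ = no λ ()
  ◇P _ ≟r atom _ = no λ ()
  ◇P _ ≟r natom _ = no λ ()
  ◇P _ ≟r (_ ∧ _) = no λ ()
  ◇P _ ≟r (_ ∨ _) = no λ ()
  ◇P _ ≟r ◇ _ = no λ ()
  ◇P _ ≟r □ _ = no λ ()

  _≟p_ : DecidableEquality (PLTL n)
  atom p ≟p atom q with p FinP.≟ q
  ... | yes refl = yes refl
  ... | no ne = no λ { refl → ne refl }
  natom p ≟p natom q with p FinP.≟ q
  ... | yes refl = yes refl
  ... | no ne = no λ { refl → ne refl }
  (a ∧ b) ≟p (c ∧ d) with a ≟p c | b ≟p d
  ... | yes refl | yes refl = yes refl
  ... | no ne | _ = no λ { refl → ne refl }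
  ... | _ | no ne = no λ { refl → ne refl }
  (a ∨ b) ≟p (c ∨ d) with a ≟p c | b ≟p d
  ... | yes refl | yes refl = yes refl
  ... | no ne | _ = no λ { refl → ne refl }
  ... | _ | no ne = no λ { refl → ne refl }
  (a U b) ≟p (c U d) with a ≟p c | b ≟p d
  ... | yes refl | yes refl = yes refl
  ... | no ne | _ = no λ { refl → ne refl }
  ... | _ | no ne = no λ { refl → ne refl }
  (a R b) ≟p (c R d) with a ≟p c | b ≟p d
  ... | yes refl | yes refl = yes refl
  ... | no ne | _ = no λ { refl → ne refl }
  ... | _ | no ne = no λ { refl → ne refl }
  X a ≟p X c with a ≟p c
  ... | yes refl = yes refl
  ... | no ne = no λ { refl → ne refl }
  ◇P a ≟p ◇P c with a ≟p c
  ... | yes refl = yes refl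
  ... | no ne = no λ { refl → ne refl }
  atom _ ≟p natom _ = no λ ()
  atom _ ≟p (_ ∧ _) = no λ ()
  atom _ ≟p (_ ∨ _) = no λ ()
  atom _ ≟p (_ U _) = no λ ()
  atom _ ≟p (_ R _) = no λ ()
  atom _ ≟p X _ = no λ ()
  atom _ ≟p ◇P _ = no λ ()
  natom _ ≟p atom _ = no λ ()
  natom _ ≟p (_ ∧ _) = no λ ()
  natom _ ≟p (_ ∨ _) = no λ ()
  natom _ ≟p (_ U _) = no λ ()
  natom _ ≟p (_ R _) = no λ ()
  natom _ ≟p X _ = no λ ()
  natom _ ≟p ◇P _ = no λ ()
  (_ ∧ _) ≟p atom _ = no λ ()
  (_ ∧ _) ≟p natom _ = no λ ()
  (_ ∧ _) ≟p (_ ∨ _) = no λ ()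
  (_ ∧ _) ≟p (_ U _) = no λ ()
  (_ ∧ _) ≟p (_ R _) = no λ ()
  (_ ∧ _) ≟p X _ = no λ ()
  (_ ∧ _) ≟p ◇P _ = no λ ()
  (_ ∨ _) ≟p atom _ = no λ ()
  (_ ∨ _) ≟p natom _ = no λ ()
  (_ ∨ _) ≟p (_ ∧ _) = no λ ()
  (_ ∨ _) ≟p (_ U _) = no λ ()
  (_ ∨ _) ≟p (_ R _) = no λ ()
  (_ ∨ _) ≟p X _ = no λ ()
  (_ ∨ _) ≟p ◇P _ = no λ ()
  (_ U _) ≟p atom _ = no λ ()
  (_ U _) ≟p natom _ = no λ ()
  (_ U _) ≟p (_ ∧ _) = no λ ()
  (_ U _) ≟p (_ ∨ _) = no λ ()
  (_ U _) ≟p (_ R _) = no λ ()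
  (_ U _) ≟p X _ = no λ ()
  (_ U _) ≟p ◇P _ = no λ ()
  (_ R _) ≟p atom _ = no λ ()
  (_ R _) ≟p natom _ = no λ ()
  (_ R _) ≟p (_ ∧ _) = no λ ()
  (_ R _) ≟p (_ ∨ _) = no λ ()
  (_ R _) ≟p (_ U _) = no λ ()
  (_ R _) ≟p X _ = no λ ()
  (_ R _) ≟p ◇P _ = no λ ()
  X _ ≟p atom _ = no λ ()
  X _ ≟p natom _ = no λ ()
  X _ ≟p (_ ∧ _) = no λ ()
  X _ ≟p (_ ∨ _) = no λ ()
  X _ ≟p (_ U _) = no λ ()
  X _ ≟p (_ R _) = no λ ()
  X _ ≟p ◇P _ = no λ ()
  ◇P _ ≟p atom _ = no λ ()
  ◇P _ ≟p natom _ = no λ ()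
  ◇P _ ≟p (_ ∧ _) = no λ ()
  ◇P _ ≟p (_ ∨ _) = no λ ()
  ◇P _ ≟p (_ U _) = no λ ()
  ◇P _ ≟p (_ R _) = no λ ()
  ◇P _ ≟p X _ = no λ ()

  subsr : rPLTL n → List (rPLTL n)
  subsr φ@(atom _)  = φ ∷ []
  subsr φ@(natom _) = φ ∷ []
  subsr φ@(a ∧ b)   = φ ∷ subsr a ++ subsr b
  subsr φ@(a ∨ b)   = φ ∷ subsr a ++ subsr b
  subsr φ@(◇ a)     = φ ∷ subsr a
  subsr φ@(□ a)     = φ ∷ subsr a
  subsr φ@(◇P a)    = φ ∷ subsr a

  subsp : PLTL n → List (PLTL n)
  subsp ψ@(atom _)  = ψ ∷ []
  subsp ψ@(natom _) = ψ ∷ []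
  subsp ψ@(a ∧ b)   = ψ ∷ subsp a ++ subsp b
  subsp ψ@(a ∨ b)   = ψ ∷ subsp a ++ subsp b
  subsp ψ@(X a)     = ψ ∷ subsp a
  subsp ψ@(a U b)   = ψ ∷ subsp a ++ subsp b
  subsp ψ@(a R b)   = ψ ∷ subsp a ++ subsp b
  subsp ψ@(◇P a)    = ψ ∷ subsp a

  sizer : rPLTL n → ℕ
  sizer φ = length (deduplicate _≟r_ (subsr φ))

  sizep : PLTL n → ℕ
  sizep ψ = length (deduplicate _≟p_ (subsp ψ))

-- The i-th bit of a robust formula is an ordinary Boolean property, expressible in
-- Prompt-LTL by a formula T φ i built homomorphically, except that the four bits of
-- a robust □ are "always", "eventually always", "infinitely often" and "eventually",
-- i.e. G, F G, G F and F of the translated bit. Since B4 is ordered bitwise,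
-- V ⪰ β is the conjunction of the bits set in β. Every subformula of that
-- conjunction is one of 13 formulas attached to a subformula of φ, so counting
-- distinct subformulas (not a syntax tree, which may be exponentially larger)
-- gives the bound 13 · |φ|.
module Submission where

open import Defs
open import Data.Nat using (ℕ; suc; _*_; _≤_)
open import Data.Product using (Σ; ∃-syntax; _×_)
open import Function.Bundles using (_⇔_)

open import Level using (0ℓ)
open import Data.Nat using (_+_; _∸_; z≤n; s≤s)
open import Data.Nat.Properties using (+-assoc; m≤m+n; m+[n∸m]≡n; *-suc; *-zeroʳ; module ≤-Reasoning)
open import Data.Fin using (Fin; zero; suc; #_)
open import Data.Bool using (true; false)
open import Data.Product using (∃; _,_)
open import Data.Product.Function.NonDependent.Propositional using (_×-⇔_)
open import Data.Sum using (inj₁; inj₂; [_,_]′)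
open import Data.Sum.Function.Propositional using (_⊎-⇔_)
open import Data.Empty using (⊥-elim)
open import Data.List using (List; []; _∷_; _++_; length; lookup; deduplicate; concatMap)
open import Data.List.Properties using (length-++; length-removeAt′)
open import Data.List.Membership.Propositional using (_∈_; lose)
open import Data.List.Membership.Propositional.Properties
  using (∈-lookup; ∈-concatMap⁺; ∈-deduplicate⁺; ∈-deduplicate⁻; ∈-++⁺ˡ; ∈-++⁺ʳ)
open import Data.List.Relation.Binary.Subset.Propositional using (_⊆_)
open import Data.List.Relation.Unary.Any using (here; there; _─_)
open import Data.List.Relation.Unary.All as All using (All; []; _∷_)
open import Data.List.Relation.Unary.All.Properties using (++⁺)
open import Data.List.Relation.Unary.AllPairs using (_∷_)
open import Data.List.Relation.Unary.Unique.Propositional using (Unique)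
open import Data.List.Relation.Unary.Unique.DecPropositional.Properties using (deduplicate-!)
open import Relation.Binary.PropositionalEquality
  using (_≡_; _≢_; refl; sym; trans; cong; cong₂; subst; module ≡-Reasoning)
open import Relation.Nullary using (¬_)
open import Function.Base using (_∘_; id)
open import Function.Bundles using (mk⇔; Equivalence)
open import Function.Construct.Identity using (⇔-id)
open import Function.Related.TypeIsomorphisms using (→-cong-⇔)
open import Function.Properties.Equivalence using (⇔-setoid)
import Relation.Binary.Reasoning.Setoid as ⇔-Reasoning

open Equivalence using (to; from)

module _ {A : Set} where

  ∈-─⁺ : ∀ {x y : A} {ys} (x∈ys : x ∈ ys) → x ≢ y → y ∈ ys → y ∈ (ys ─ x∈ys)
  ∈-─⁺ (here refl) x≢y (here refl) = ⊥-elim (x≢y refl)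
  ∈-─⁺ (here refl) x≢y (there y∈ys) = y∈ys
  ∈-─⁺ (there x∈ys) x≢y (here y≡z) = here y≡z
  ∈-─⁺ (there x∈ys) x≢y (there y∈ys) = there (∈-─⁺ x∈ys x≢y y∈ys)

  Unique∧⊆⇒length≤ : ∀ {xs ys : List A} → Unique xs → xs ⊆ ys → length xs ≤ length ys
  Unique∧⊆⇒length≤ {[]} _ _ = z≤n
  Unique∧⊆⇒length≤ {x ∷ xs} {ys} (x∉xs ∷ xs!) xs⊆ys =
    subst (suc (length xs) ≤_) (sym (length-removeAt′ ys _))
      (s≤s (Unique∧⊆⇒length≤ xs! λ y∈xs →
        ∈-─⁺ x∈ys (All.lookup x∉xs y∈xs) (xs⊆ys (there y∈xs))))
    where
    x∈ys : x ∈ ys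
    x∈ys = xs⊆ys (here refl)

module _ {A B : Set} (f : A → List B) {c : ℕ} (|f|≡c : ∀ a → length (f a) ≡ c) where

  length-concatMap-const : ∀ (xs : List A) → length (concatMap f xs) ≡ c * length xs
  length-concatMap-const [] = sym (*-zeroʳ c)
  length-concatMap-const (x ∷ xs) = begin
    length (f x ++ concatMap f xs)             ≡⟨ length-++ (f x) ⟩
    length (f x) + length (concatMap f xs)     ≡⟨ cong₂ _+_ (|f|≡c x) (length-concatMap-const xs) ⟩
    c + c * length xs                          ≡⟨ sym (*-suc c (length xs)) ⟩
    c * suc (length xs)                        ∎
    where open ≡-Reasoning

∀-cong-⇔ : ∀ {A : Set} {P Q : A → Set} → (∀ a → P a ⇔ Q a) → (∀ a → P a) ⇔ (∀ a → Q a)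
∀-cong-⇔ P⇔Q = mk⇔ (λ p a → to (P⇔Q a) (p a)) (λ q a → from (P⇔Q a) (q a))

∃-cong-⇔ : ∀ {A : Set} {P Q : A → Set} → (∀ a → P a ⇔ Q a) → ∃ P ⇔ ∃ Q
∃-cong-⇔ P⇔Q = mk⇔ (λ (a , p) → a , to (P⇔Q a) p) (λ (a , q) → a , from (P⇔Q a) q)

module _ {n : ℕ} where

  _≐_ : Trace n → Trace n → Set
  w ≐ w′ = ∀ i p → w i p ≡ w′ i p

  suffix-+ : ∀ (w : Trace n) a b → suffix (suffix w a) b ≐ suffix w (a + b)
  suffix-+ w a b i p = cong (λ j → w j p) (sym (+-assoc a b i))

  Vp-resp-≐ : ∀ {w w′ k} ψ → w ≐ w′ → Vp w k ψ → Vp w′ k ψ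
  Vp-resp-≐ (atom p) w≐w′ v = trans (sym (w≐w′ 0 p)) v
  Vp-resp-≐ (natom p) w≐w′ v = trans (sym (w≐w′ 0 p)) v
  Vp-resp-≐ (ψ ∧ χ) w≐w′ (v , u) = Vp-resp-≐ ψ w≐w′ v , Vp-resp-≐ χ w≐w′ u
  Vp-resp-≐ (ψ ∨ χ) w≐w′ (inj₁ v) = inj₁ (Vp-resp-≐ ψ w≐w′ v)
  Vp-resp-≐ (ψ ∨ χ) w≐w′ (inj₂ u) = inj₂ (Vp-resp-≐ χ w≐w′ u)
  Vp-resp-≐ (X ψ) w≐w′ v = Vp-resp-≐ ψ (λ i → w≐w′ (1 + i)) v
  Vp-resp-≐ (ψ U χ) w≐w′ (j , u , v) =
    j , Vp-resp-≐ χ (λ i → w≐w′ (j + i)) u ,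
    λ j′ j′<j → Vp-resp-≐ ψ (λ i → w≐w′ (j′ + i)) (v j′ j′<j)
  Vp-resp-≐ (ψ R χ) w≐w′ v j with v j
  ... | inj₁ u = inj₁ (Vp-resp-≐ χ (λ i → w≐w′ (j + i)) u)
  ... | inj₂ (j′ , j′≤j , u) = inj₂ (j′ , j′≤j , Vp-resp-≐ ψ (λ i → w≐w′ (j′ + i)) u)
  Vp-resp-≐ (◇P ψ) w≐w′ (j , j≤k , v) = j , j≤k , Vp-resp-≐ ψ (λ i → w≐w′ (j + i)) v

  module _ (w : Trace n) (k : ℕ) (ψ : PLTL n) where

    Vp-suffix-+ : ∀ a b → Vp (suffix (suffix w a) b) k ψ ⇔ Vp (suffix w (a + b)) k ψ
    Vp-suffix-+ a b =
      mk⇔ (Vp-resp-≐ ψ (suffix-+ w a b)) (Vp-resp-≐ ψ λ i p → sym (suffix-+ w a b i p))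

    Vp-suffix-∸ : ∀ {a b} → a ≤ b → Vp (suffix (suffix w a) (b ∸ a)) k ψ ⇔ Vp (suffix w b) k ψ
    Vp-suffix-∸ {a} {b} a≤b =
      subst (λ j → Vp (suffix (suffix w a) (b ∸ a)) k ψ ⇔ Vp (suffix w j) k ψ)
            (m+[n∸m]≡n a≤b) (Vp-suffix-+ a (b ∸ a))

    ∀-suffix⇔∀≥ : ∀ a → (∀ j → Vp (suffix (suffix w a) j) k ψ) ⇔ (∀ j → a ≤ j → Vp (suffix w j) k ψ)
    ∀-suffix⇔∀≥ a = mk⇔
      (λ v j a≤j → to (Vp-suffix-∸ a≤j) (v (j ∸ a)))
      (λ v j → from (Vp-suffix-+ a j) (v (a + j) (m≤m+n a j)))

    ∃-suffix⇔∃≥ : ∀ a → (∃[ j ] Vp (suffix (suffix w a) j) k ψ) ⇔ (∃[ j ] a ≤ j × Vp (suffix w j) k ψ)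
    ∃-suffix⇔∃≥ a = mk⇔
      (λ (j , v) → a + j , m≤m+n a j , to (Vp-suffix-+ a j) v)
      (λ (j , a≤j , v) → j ∸ a , from (Vp-suffix-∸ a≤j) v)

⪰-cong : ∀ {U V : Fin 4 → Set} → (∀ i → U i ⇔ V i) → ∀ β → (U ⪰ β) ⇔ (V ⪰ β)
⪰-cong U⇔V β = ∀-cong-⇔ λ i → →-cong-⇔ (⇔-id _) (U⇔V i)

⪰-intro : ∀ {V : Fin 4 → Set} β →
          (bit β (# 0) ≡ true → V (# 0)) → (bit β (# 1) ≡ true → V (# 1)) →
          (bit β (# 2) ≡ true → V (# 2)) → (bit β (# 3) ≡ true → V (# 3)) → V ⪰ β
⪰-intro β v₀ v₁ v₂ v₃ zero = v₀
⪰-intro β v₀ v₁ v₂ v₃ (suc zero) = v₁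
⪰-intro β v₀ v₁ v₂ v₃ (suc (suc zero)) = v₂
⪰-intro β v₀ v₁ v₂ v₃ (suc (suc (suc zero))) = v₃

∈-subsr-self : ∀ {n} (φ : rPLTL n) → φ ∈ subsr φ
∈-subsr-self (atom _) = here refl
∈-subsr-self (natom _) = here refl
∈-subsr-self (_ ∧ _) = here refl
∈-subsr-self (_ ∨ _) = here refl
∈-subsr-self (◇ _) = here refl
∈-subsr-self (□ _) = here refl
∈-subsr-self (◇P _) = here refl

module Translation (m : ℕ) where

  N : ℕ
  N = suc m

  ⊤ₚ ⊥ₚ : PLTL N
  ⊤ₚ = atom zero ∨ natom zero
  ⊥ₚ = atom zero ∧ natom zero

  F G : PLTL N → PLTL N
  F ψ = ⊤ₚ U ψ
  G ψ = ⊥ₚ R ψ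

  T : rPLTL N → Fin 4 → PLTL N
  T (atom p) i = atom p
  T (natom p) i = natom p
  T (φ ∧ χ) i = T φ i ∧ T χ i
  T (φ ∨ χ) i = T φ i ∨ T χ i
  T (◇ φ) i = F (T φ i)
  T (◇P φ) i = ◇P (T φ i)
  T (□ φ) zero = G (T φ zero)
  T (□ φ) (suc zero) = F (G (T φ (# 1)))
  T (□ φ) (suc (suc zero)) = G (F (T φ (# 2)))
  T (□ φ) (suc (suc (suc zero))) = F (T φ (# 3))

  conj : (Fin 4 → PLTL N) → B4 → PLTL N
  conj t b0000 = ⊤ₚ
  conj t b0001 = t (# 3)
  conj t b0011 = t (# 2) ∧ t (# 3)
  conj t b0111 = t (# 1) ∧ (t (# 2) ∧ t (# 3))
  conj t b1111 = t (# 0) ∧ (t (# 1) ∧ (t (# 2) ∧ t (# 3)))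

  Tβ : rPLTL N → B4 → PLTL N
  Tβ φ = conj (T φ)

  Vp-⊤ : ∀ w k → Vp w k ⊤ₚ
  Vp-⊤ w k with w 0 zero
  ... | true = inj₁ refl
  ... | false = inj₂ refl

  Vp-⊥ : ∀ w k → ¬ Vp w k ⊥ₚ
  Vp-⊥ w k (holds , fails) with () ← trans (sym holds) fails

  module _ (w : Trace N) (k : ℕ) where

    Vp-F : ∀ ψ → Vp w k (F ψ) ⇔ (∃[ j ] Vp (suffix w j) k ψ)
    Vp-F ψ = mk⇔ (λ (j , v , _) → j , v) (λ (j , v) → j , v , λ j′ _ → Vp-⊤ (suffix w j′) k)

    Vp-G : ∀ ψ → Vp w k (G ψ) ⇔ (∀ j → Vp (suffix w j) k ψ)
    Vp-G ψ = mk⇔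
      (λ v j → [ id , (λ (j′ , _ , v⊥) → ⊥-elim (Vp-⊥ (suffix w j′) k v⊥)) ]′ (v j))
      (λ v j → inj₁ (v j))

    Vp-conj : ∀ t β → Vp w k (conj t β) ⇔ ((λ i → Vp w k (t i)) ⪰ β)
    Vp-conj t b0000 = mk⇔ (λ _ _ ()) (λ _ → Vp-⊤ w k)
    Vp-conj t b0001 = mk⇔
      (λ v₃ → ⪰-intro b0001 (λ ()) (λ ()) (λ ()) (λ _ → v₃))
      (λ v → v (# 3) refl)
    Vp-conj t b0011 = mk⇔
      (λ (v₂ , v₃) → ⪰-intro b0011 (λ ()) (λ ()) (λ _ → v₂) (λ _ → v₃))
      (λ v → v (# 2) refl , v (# 3) refl)
    Vp-conj t b0111 = mk⇔
      (λ (v₁ , v₂ , v₃) → ⪰-intro b0111 (λ ()) (λ _ → v₁) (λ _ → v₂) (λ _ → v₃))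
      (λ v → v (# 1) refl , v (# 2) refl , v (# 3) refl)
    Vp-conj t b1111 = mk⇔
      (λ (v₀ , v₁ , v₂ , v₃) → ⪰-intro b1111 (λ _ → v₀) (λ _ → v₁) (λ _ → v₂) (λ _ → v₃))
      (λ v → v (# 0) refl , v (# 1) refl , v (# 2) refl , v (# 3) refl)

  T-correct : ∀ φ i {w k} → Vr w k φ i ⇔ Vp w k (T φ i)
  T-correct (atom p) i = ⇔-id _
  T-correct (natom p) i = ⇔-id _
  T-correct (φ ∧ χ) i = T-correct φ i ×-⇔ T-correct χ i
  T-correct (φ ∨ χ) i = T-correct φ i ⊎-⇔ T-correct χ i
  T-correct (◇ φ) i {w} {k} = begin
    (∃[ j ] Vr (suffix w j) k φ i)        ≈⟨ ∃-cong-⇔ (λ j → T-correct φ i) ⟩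
    (∃[ j ] Vp (suffix w j) k (T φ i))    ≈⟨ Vp-F w k (T φ i) ⟨
    Vp w k (F (T φ i))                    ∎
    where open ⇔-Reasoning (⇔-setoid 0ℓ)
  T-correct (◇P φ) i = ∃-cong-⇔ λ j → ⇔-id _ ×-⇔ T-correct φ i
  T-correct (□ φ) zero {w} {k} = begin
    (∀ j → Vr (suffix w j) k φ (# 0))        ≈⟨ ∀-cong-⇔ (λ j → T-correct φ (# 0)) ⟩
    (∀ j → Vp (suffix w j) k (T φ (# 0)))    ≈⟨ Vp-G w k (T φ (# 0)) ⟨
    Vp w k (G (T φ (# 0)))                   ∎
    where open ⇔-Reasoning (⇔-setoid 0ℓ)
  T-correct (□ φ) (suc zero) {w} {k} = begin
    (∃[ a ] ∀ j → a ≤ j → Vr (suffix w j) k φ (# 1))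
      ≈⟨ ∃-cong-⇔ (λ a → ∀-cong-⇔ λ j → →-cong-⇔ (⇔-id _) (T-correct φ (# 1))) ⟩
    (∃[ a ] ∀ j → a ≤ j → Vp (suffix w j) k t)
      ≈⟨ ∃-cong-⇔ (∀-suffix⇔∀≥ w k t) ⟨
    (∃[ a ] ∀ j → Vp (suffix (suffix w a) j) k t)
      ≈⟨ ∃-cong-⇔ (λ a → Vp-G (suffix w a) k t) ⟨
    (∃[ a ] Vp (suffix w a) k (G t))
      ≈⟨ Vp-F w k (G t) ⟨
    Vp w k (F (G t))
      ∎
    where
    open ⇔-Reasoning (⇔-setoid 0ℓ)
    t : PLTL N
    t = T φ (# 1)
  T-correct (□ φ) (suc (suc zero)) {w} {k} = begin
    (∀ a → ∃[ j ] a ≤ j × Vr (suffix w j) k φ (# 2))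
      ≈⟨ ∀-cong-⇔ (λ a → ∃-cong-⇔ λ j → ⇔-id _ ×-⇔ T-correct φ (# 2)) ⟩
    (∀ a → ∃[ j ] a ≤ j × Vp (suffix w j) k t)
      ≈⟨ ∀-cong-⇔ (∃-suffix⇔∃≥ w k t) ⟨
    (∀ a → ∃[ j ] Vp (suffix (suffix w a) j) k t)
      ≈⟨ ∀-cong-⇔ (λ a → Vp-F (suffix w a) k t) ⟨
    (∀ a → Vp (suffix w a) k (F t))
      ≈⟨ Vp-G w k (F t) ⟨
    Vp w k (G (F t))
      ∎
    where
    open ⇔-Reasoning (⇔-setoid 0ℓ)
    t : PLTL N
    t = T φ (# 2)
  T-correct (□ φ) (suc (suc (suc zero))) {w} {k} = begin
    (∃[ j ] Vr (suffix w j) k φ (# 3))        ≈⟨ ∃-cong-⇔ (λ j → T-correct φ (# 3)) ⟩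
    (∃[ j ] Vp (suffix w j) k (T φ (# 3)))    ≈⟨ Vp-F w k (T φ (# 3)) ⟨
    Vp w k (F (T φ (# 3)))                    ∎
    where open ⇔-Reasoning (⇔-setoid 0ℓ)

  Tβ-correct : ∀ φ β {w k} → (Vr w k φ ⪰ β) ⇔ Vp w k (Tβ φ β)
  Tβ-correct φ β {w} {k} = begin
    (Vr w k φ ⪰ β)                        ≈⟨ ⪰-cong (λ i → T-correct φ i) β ⟩
    ((λ i → Vp w k (T φ i)) ⪰ β)          ≈⟨ Vp-conj w k (T φ) β ⟨
    Vp w k (Tβ φ β)                       ∎
    where open ⇔-Reasoning (⇔-setoid 0ℓ)

  pieces : rPLTL N → List (PLTL N)
  pieces s = T s (# 0) ∷ T s (# 1) ∷ T s (# 2) ∷ T s (# 3)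
    ∷ G (T s (# 1)) ∷ F (T s (# 2))
    ∷ ⊤ₚ ∷ ⊥ₚ ∷ atom zero ∷ natom zero
    ∷ Tβ s b0011 ∷ Tβ s b0111 ∷ Tβ s b1111 ∷ []

  InClosure : rPLTL N → PLTL N → Set
  InClosure φ ψ = ∃[ s ] s ∈ subsr φ × ψ ∈ pieces s

  piece : ∀ s j → InClosure s (lookup (pieces s) j)
  piece s j = s , ∈-subsr-self s , ∈-lookup j

  T-piece : ∀ s i → InClosure s (T s i)
  T-piece s zero = piece s (# 0)
  T-piece s (suc zero) = piece s (# 1)
  T-piece s (suc (suc zero)) = piece s (# 2)
  T-piece s (suc (suc (suc zero))) = piece s (# 3)

  subsp-⊤ : ∀ s → All (InClosure s) (subsp ⊤ₚ)
  subsp-⊤ s = piece s (# 6) ∷ piece s (# 8) ∷ piece s (# 9) ∷ []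

  subsp-⊥ : ∀ s → All (InClosure s) (subsp ⊥ₚ)
  subsp-⊥ s = piece s (# 7) ∷ piece s (# 8) ∷ piece s (# 9) ∷ []

  InClosure-mono : ∀ {φ} χ → subsr φ ⊆ subsr χ →
                   ∀ {ψs} → All (InClosure φ) ψs → All (InClosure χ) ψs
  InClosure-mono χ φ⊆χ = All.map λ (s , s∈φ , ψ∈s) → s , φ⊆χ s∈φ , ψ∈s

  subsp-T : ∀ φ i → All (InClosure φ) (subsp (T φ i))
  subsp-T (atom p) i = T-piece (atom p) i ∷ []
  subsp-T (natom p) i = T-piece (natom p) i ∷ []
  subsp-T (φ ∧ χ) i = T-piece (φ ∧ χ) i ∷
    ++⁺ (InClosure-mono (φ ∧ χ) (there ∘ ∈-++⁺ˡ) (subsp-T φ i))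
        (InClosure-mono (φ ∧ χ) (there ∘ ∈-++⁺ʳ (subsr φ)) (subsp-T χ i))
  subsp-T (φ ∨ χ) i = T-piece (φ ∨ χ) i ∷
    ++⁺ (InClosure-mono (φ ∨ χ) (there ∘ ∈-++⁺ˡ) (subsp-T φ i))
        (InClosure-mono (φ ∨ χ) (there ∘ ∈-++⁺ʳ (subsr φ)) (subsp-T χ i))
  subsp-T (◇ φ) i = T-piece (◇ φ) i ∷
    ++⁺ (subsp-⊤ (◇ φ)) (InClosure-mono (◇ φ) there (subsp-T φ i))
  subsp-T (◇P φ) i = T-piece (◇P φ) i ∷ InClosure-mono (◇P φ) there (subsp-T φ i)
  subsp-T (□ φ) zero = T-piece (□ φ) zero ∷
    ++⁺ (subsp-⊥ (□ φ)) (InClosure-mono (□ φ) there (subsp-T φ (# 0)))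
  subsp-T (□ φ) (suc zero) = T-piece (□ φ) (# 1) ∷
    ++⁺ (subsp-⊤ (□ φ)) (InClosure-mono (□ φ) there (piece φ (# 4) ∷
      ++⁺ (subsp-⊥ φ) (subsp-T φ (# 1))))
  subsp-T (□ φ) (suc (suc zero)) = T-piece (□ φ) (# 2) ∷
    ++⁺ (subsp-⊥ (□ φ)) (InClosure-mono (□ φ) there (piece φ (# 5) ∷
      ++⁺ (subsp-⊤ φ) (subsp-T φ (# 2))))
  subsp-T (□ φ) (suc (suc (suc zero))) = T-piece (□ φ) (# 3) ∷
    ++⁺ (subsp-⊤ (□ φ)) (InClosure-mono (□ φ) there (subsp-T φ (# 3)))

  subsp-Tβ : ∀ φ β → All (InClosure φ) (subsp (Tβ φ β))
  subsp-Tβ φ b0000 = subsp-⊤ φ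
  subsp-Tβ φ b0001 = subsp-T φ (# 3)
  subsp-Tβ φ b0011 = piece φ (# 10) ∷ ++⁺ (subsp-T φ (# 2)) (subsp-T φ (# 3))
  subsp-Tβ φ b0111 = piece φ (# 11) ∷ ++⁺ (subsp-T φ (# 1))
    (piece φ (# 10) ∷ ++⁺ (subsp-T φ (# 2)) (subsp-T φ (# 3)))
  subsp-Tβ φ b1111 = piece φ (# 12) ∷ ++⁺ (subsp-T φ (# 0))
    (piece φ (# 11) ∷ ++⁺ (subsp-T φ (# 1))
      (piece φ (# 10) ∷ ++⁺ (subsp-T φ (# 2)) (subsp-T φ (# 3))))

  size-Tβ : ∀ φ β → sizep (Tβ φ β) ≤ 13 * sizer φ
  size-Tβ φ β = begin
    sizep (Tβ φ β)                           ≤⟨ Unique∧⊆⇒length≤ (deduplicate-! _≟p_ _) closure ⟩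
    length (concatMap pieces subformulas)    ≡⟨ length-concatMap-const pieces (λ _ → refl) subformulas ⟩
    13 * sizer φ                             ∎
    where
    open ≤-Reasoning
    subformulas : List (rPLTL N)
    subformulas = deduplicate _≟r_ (subsr φ)
    closure : deduplicate _≟p_ (subsp (Tβ φ β)) ⊆ concatMap pieces subformulas
    closure ψ∈ with All.lookup (subsp-Tβ φ β) (∈-deduplicate⁻ _≟p_ (subsp (Tβ φ β)) ψ∈)
    ... | s , s∈φ , ψ∈s = ∈-concatMap⁺ pieces (lose (∈-deduplicate⁺ _≟r_ s∈φ) ψ∈s)

lemma1 : (m : ℕ) → ∃[ c ] ((φ : rPLTL (suc m)) (β : B4) →
    Σ (PLTL (suc m)) λ φβ →
    sizep φβ ≤ c * sizer φ
    × ((w : Trace (suc m)) (k : ℕ) → (Vr w k φ ⪰ β) ⇔ Vp w k φβ))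
lemma1 m = 13 , λ φ β → Tβ φ β , size-Tβ φ β , λ w k → Tβ-correct φ β
  where open Translation m
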